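{- Let $E$ be a finite set, $\mathcal{L}$ a set of subsets of $E$, and suppose the toggle group $T(\mathcal{L})$ acts transitively on $\mathcal{L}$. Fix a system of blocks for $T(\mathcal{L})$. Let $\sigma\in T(\mathcal{L})$ be a product of type 1 toggles. Then for each block $\mathcal{B}$ there exists a set $X\subseteq E$ such that $\sigma(A)=A\triangle X$ for every $A\in\mathcal{B}$. In particular, if $\sigma(\mathcal{B})=\mathcal{B}$ then $\sigma|_{\mathcal{B}}$ is either the identity or an involution with no fixed points.
   Context: For $e\in E$, the toggle $\tau_e:\mathcal{L}\to\mathcal{L}$ is defined by $\tau_e(X)=X\triangle\{e\}$ if $X\triangle\{e\}\in\mathcal{L}$, and $\tau_e(X)=X$ otherwise. The toggle group $T(\mathcal{L})$ is the subgroup of the symmetric group on $\mathcal{L}$ generated by $\{\tau_e: e\in E\}$. Convention: every $e\in E$ for which $\tau_e$ is the identity permutation is removed from $E$. A block for $T(\mathcal{L})$ is a subset $\mathcal{B}\subseteq\mathcal{L}$ such that for every $g\in T(\mathcal{L})$ either $g(\mathcal{B})=\mathcal{B}$ or $g(\mathcal{B})\cap\mathcal{B}=\emptyset$; a system of blocks is the partition $\{g(\mathcal{B}):g\in T(\mathcal{L})\}$ of $\mathcal{L}$ for a block $\mathcal{B}$. Relative to the fixed block system, an element $g\in T(\mathcal{L})$ (in particular a toggle) is type 2 if $g(\mathcal{B})=\mathcal{B}$ for every block $\mathcal{B}$ of the system, and type 1 otherwise. -}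

module Defs where

open import Data.Nat using (ℕ)
open import Data.Bool using (Bool; true; false; if_then_else_; _xor_)
open import Data.Fin using (Fin)
open import Data.Fin.Subset using (Subset; ⁅_⁆)
open import Data.Vec using (zipWith)
open import Data.List using (List; []; _∷_)
open import Data.List.Relation.Unary.All using (All)
open import Data.Sum using (_⊎_)
open import Data.Product using (Σ; _×_; ∃; ∃-syntax)
open import Relation.Binary.PropositionalEquality using (_≡_)
open import Relation.Nullary using (¬_)

-- The ground set E is Fin n; subsets of E are Subset n.
-- A family 𝓛 of subsets of E is given by its (Boolean) membership function.
Family : ℕ → Set
Family n = Subset n → Bool

_∈L_ : ∀ {n} → Subset n → Family n → Set
A ∈L 𝓛 = 𝓛 A ≡ true

_△_ : ∀ {n} → Subset n → Subset n → Subset n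
_△_ = zipWith _xor_

toggle : ∀ {n} → Family n → Fin n → Subset n → Subset n
toggle 𝓛 e X = if 𝓛 (X △ ⁅ e ⁆) then X △ ⁅ e ⁆ else X

-- Elements of the toggle group T(𝓛) are represented by words in the
-- generators (each τ_e is an involution, so words suffice); a word acts
-- as the composite of its toggles (rightmost applied first).
Word : ℕ → Set
Word n = List (Fin n)

act : ∀ {n} → Family n → Word n → Subset n → Subset n
act 𝓛 []      X = X
act 𝓛 (e ∷ w) X = toggle 𝓛 e (act 𝓛 w X)

Pred : ℕ → Set₁
Pred n = Subset n → Set

Transitive : ∀ {n} → Family n → Set
Transitive {n} 𝓛 = ∀ A B → A ∈L 𝓛 → B ∈L 𝓛 → ∃[ w ] act 𝓛 w A ≡ B

image : ∀ {n} → Family n → Word n → Pred n → Pred n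
image 𝓛 g 𝓑 A = ∃[ C ] (𝓑 C × act 𝓛 g C ≡ A)

Stabilises : ∀ {n} → Family n → Word n → Pred n → Set
Stabilises 𝓛 g 𝓑 = (∀ A → image 𝓛 g 𝓑 A → 𝓑 A) × (∀ A → 𝓑 A → image 𝓛 g 𝓑 A)

DisjointImage : ∀ {n} → Family n → Word n → Pred n → Set
DisjointImage 𝓛 g 𝓑 = ∀ A → image 𝓛 g 𝓑 A → ¬ 𝓑 A

IsBlock : ∀ {n} → Family n → Pred n → Set
IsBlock {n} 𝓛 𝓑 =
  (∀ A → 𝓑 A → A ∈L 𝓛) ×
  (∃[ A ] 𝓑 A) ×
  (∀ (g : Word n) → Stabilises 𝓛 g 𝓑 ⊎ DisjointImage 𝓛 g 𝓑)

-- The system of blocks generated by a block 𝓑₀ is {g(𝓑₀)}; its blocks are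
-- indexed by words g.  An element h is type 2 if it fixes every block of
-- the system, type 1 otherwise.
Type2 : ∀ {n} → Family n → Pred n → Word n → Set
Type2 {n} 𝓛 𝓑₀ h = ∀ (g : Word n) → Stabilises 𝓛 h (image 𝓛 g 𝓑₀)

Type1 : ∀ {n} → Family n → Pred n → Word n → Set
Type1 𝓛 𝓑₀ h = ¬ Type2 𝓛 𝓑₀ h

Type1Toggle : ∀ {n} → Family n → Pred n → Fin n → Set
Type1Toggle 𝓛 𝓑₀ e = Type1 𝓛 𝓑₀ (e ∷ [])

-- A toggle τ_e either fixes or moves each member of a block.  If it fixed some member of a
-- block and moved another, it would map that block to itself, and this "split" behaviour
-- propagates from a block g(𝓑₀) to τ_f g(𝓑₀) (when τ_f does not fix the block, it acts on it as
-- X ↦ X △ {f}, which commutes with X ↦ X △ {e}); so τ_e would fix every block and be type 2.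
-- Hence a type 1 toggle acts on every block as A ↦ A △ ∅ or A ↦ A △ {e}.  Since τ_e sends
-- blocks to blocks, a product of type 1 toggles acts on each block as A ↦ A △ X, and a
-- translation A ↦ A △ X is the identity (X = ∅) or a fixed-point-free involution.
module Submission where

open import Defs
open import Data.Nat using (ℕ)
open import Data.Bool using (true; false)
import Data.Bool as Bool
open import Data.Bool.Properties
  using (xor-assoc; xor-comm; xor-same; xor-identityˡ; xor-identityʳ)
open import Data.Fin using (Fin)
open import Data.Fin.Subset using (Subset; ⁅_⁆) renaming (⊥ to ∅)
open import Data.Vec using ([]; _∷_)
open import Data.Vec.Properties
  using (≡-dec; zipWith-assoc; zipWith-comm; zipWith-identityˡ; zipWith-identityʳ)
open import Data.List using ([]; _∷_; _++_; [_]; reverse)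
open import Data.List.Properties using (++-assoc; unfold-reverse; reverse-involutive)
open import Data.List.Relation.Unary.All using (All; []; _∷_)
open import Data.Product using (_×_; ∃; ∃-syntax; _,_; proj₁; proj₂)
open import Data.Sum using (_⊎_; inj₁; inj₂)
open import Relation.Binary.PropositionalEquality hiding ([_])
open import Relation.Nullary using (¬_; Dec; yes; no; contradiction)
open import Relation.Nullary.Decidable using (decidable-stable)
open import Relation.Unary using (_⊆_)

private variable n : ℕ

△-assoc : (X Y Z : Subset n) → (X △ Y) △ Z ≡ X △ (Y △ Z)
△-assoc = zipWith-assoc xor-assoc

△-comm : (X Y : Subset n) → X △ Y ≡ Y △ X
△-comm = zipWith-comm xor-comm

△-identityˡ : (X : Subset n) → ∅ △ X ≡ X
△-identityˡ = zipWith-identityˡ xor-identityˡ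

△-identityʳ : (X : Subset n) → X △ ∅ ≡ X
△-identityʳ = zipWith-identityʳ xor-identityʳ

△-self : (X : Subset n) → X △ X ≡ ∅
△-self []      = refl
△-self (x ∷ X) = cong₂ _∷_ (xor-same x) (△-self X)

△-cancelʳ : (X Y : Subset n) → (X △ Y) △ Y ≡ X
△-cancelʳ X Y = begin
  (X △ Y) △ Y  ≡⟨ △-assoc X Y Y ⟩
  X △ (Y △ Y)  ≡⟨ cong (X △_) (△-self Y) ⟩
  X △ ∅        ≡⟨ △-identityʳ X ⟩
  X            ∎
  where open ≡-Reasoning

△-cancelˡ : (X Y : Subset n) → X △ (X △ Y) ≡ Y
△-cancelˡ X Y = begin
  X △ (X △ Y)  ≡⟨ △-assoc X X Y ⟨
  (X △ X) △ Y  ≡⟨ cong (_△ Y) (△-self X) ⟩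
  ∅ △ Y        ≡⟨ △-identityˡ Y ⟩
  Y            ∎
  where open ≡-Reasoning

△-swapʳ : (X Y Z : Subset n) → (X △ Y) △ Z ≡ (X △ Z) △ Y
△-swapʳ X Y Z = begin
  (X △ Y) △ Z  ≡⟨ △-assoc X Y Z ⟩
  X △ (Y △ Z)  ≡⟨ cong (X △_) (△-comm Y Z) ⟩
  X △ (Z △ Y)  ≡⟨ △-assoc X Z Y ⟨
  (X △ Z) △ Y  ∎
  where open ≡-Reasoning

△≡self⇒∅ : (A X : Subset n) → A △ X ≡ A → X ≡ ∅
△≡self⇒∅ A X A△X≡A = begin
  X            ≡⟨ △-cancelˡ A X ⟨
  A △ (A △ X)  ≡⟨ cong (A △_) A△X≡A ⟩
  A △ A        ≡⟨ △-self A ⟩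
  ∅            ∎
  where open ≡-Reasoning

MapsInto : (Subset n → Subset n) → Pred n → Set
MapsInto f Q = ∀ {X} → Q X → Q (f X)

ActsAsTranslation : (Subset n → Subset n) → Pred n → Subset n → Set
ActsAsTranslation f Q X = ∀ A → Q A → f A ≡ A △ X

translation-trivial-or-free :
  {f : Subset n → Subset n} {Q : Pred n} (X : Subset n) →
  ActsAsTranslation f Q X → MapsInto f Q →
  (∀ A → Q A → f A ≡ A) ⊎ (∀ A → Q A → (f (f A) ≡ A) × ¬ (f A ≡ A))
translation-trivial-or-free {f = f} {Q = Q} X f≡△X into with ≡-dec Bool._≟_ X ∅
... | yes refl = inj₁ λ A qA → trans (f≡△X A qA) (△-identityʳ A)
... | no X≢∅   = inj₂ λ A qA → involutive A qA , λ fA≡A →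
        X≢∅ (△≡self⇒∅ A X (trans (sym (f≡△X A qA)) fA≡A))
  where
  involutive : ∀ A → Q A → f (f A) ≡ A
  involutive A qA = begin
    f (f A)      ≡⟨ f≡△X (f A) (into qA) ⟩
    f A △ X      ≡⟨ cong (_△ X) (f≡△X A qA) ⟩
    (A △ X) △ X  ≡⟨ △-cancelʳ A X ⟩
    A            ∎
    where open ≡-Reasoning

module Toggles (𝓛 : Family n) where

  Moves : Fin n → Subset n → Set
  Moves e X = (X △ ⁅ e ⁆) ∈L 𝓛

  moves? : ∀ e X → Dec (Moves e X)
  moves? e X = 𝓛 (X △ ⁅ e ⁆) Bool.≟ true

  toggle-moved : ∀ {e X} → Moves e X → toggle 𝓛 e X ≡ X △ ⁅ e ⁆
  toggle-moved m rewrite m = refl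

  toggle-fixed : ∀ {e X} → ¬ Moves e X → toggle 𝓛 e X ≡ X
  toggle-fixed {e} {X} ¬m with 𝓛 (X △ ⁅ e ⁆)
  ... | true  = contradiction refl ¬m
  ... | false = refl

  toggle-∈ : ∀ e {X} → X ∈L 𝓛 → toggle 𝓛 e X ∈L 𝓛
  toggle-∈ e {X} X∈𝓛 with moves? e X
  ... | yes m = subst (_∈L 𝓛) (sym (toggle-moved m)) m
  ... | no ¬m = subst (_∈L 𝓛) (sym (toggle-fixed ¬m)) X∈𝓛

  toggle-involutive : ∀ e {X} → X ∈L 𝓛 → toggle 𝓛 e (toggle 𝓛 e X) ≡ X
  toggle-involutive e {X} X∈𝓛 with moves? e X
  ... | no ¬m = trans (cong (toggle 𝓛 e) (toggle-fixed ¬m)) (toggle-fixed ¬m)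
  ... | yes m = begin
    toggle 𝓛 e (toggle 𝓛 e X)      ≡⟨ cong (toggle 𝓛 e) (toggle-moved m) ⟩
    toggle 𝓛 e (X △ ⁅ e ⁆)         ≡⟨ toggle-moved moved-back ⟩
    (X △ ⁅ e ⁆) △ ⁅ e ⁆            ≡⟨ △-cancelʳ X ⁅ e ⁆ ⟩
    X                              ∎
    where
    open ≡-Reasoning
    moved-back : Moves e (X △ ⁅ e ⁆)
    moved-back = subst (_∈L 𝓛) (sym (△-cancelʳ X ⁅ e ⁆)) X∈𝓛

  act-∈ : ∀ w {X} → X ∈L 𝓛 → act 𝓛 w X ∈L 𝓛
  act-∈ []      X∈𝓛 = X∈𝓛
  act-∈ (e ∷ w) X∈𝓛 = toggle-∈ e (act-∈ w X∈𝓛)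

  act-++ : ∀ u v X → act 𝓛 (u ++ v) X ≡ act 𝓛 u (act 𝓛 v X)
  act-++ []      v X = refl
  act-++ (e ∷ u) v X = cong (toggle 𝓛 e) (act-++ u v X)

  act-reverse-act : ∀ w {X} → X ∈L 𝓛 → act 𝓛 (reverse w) (act 𝓛 w X) ≡ X
  act-reverse-act []      X∈𝓛 = refl
  act-reverse-act (e ∷ w) {X} X∈𝓛 = begin
    act 𝓛 (reverse (e ∷ w)) (act 𝓛 (e ∷ w) X)       ≡⟨ cong (λ u → act 𝓛 u (act 𝓛 (e ∷ w) X)) (unfold-reverse e w) ⟩
    act 𝓛 (reverse w ++ [ e ]) (act 𝓛 (e ∷ w) X)    ≡⟨ act-++ (reverse w) [ e ] _ ⟩
    act 𝓛 (reverse w) (toggle 𝓛 e (toggle 𝓛 e Y))   ≡⟨ cong (act 𝓛 (reverse w)) (toggle-involutive e (act-∈ w X∈𝓛)) ⟩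
    act 𝓛 (reverse w) Y                             ≡⟨ act-reverse-act w X∈𝓛 ⟩
    X                                               ∎
    where
    open ≡-Reasoning
    Y = act 𝓛 w X

  act-act-reverse : ∀ w {X} → X ∈L 𝓛 → act 𝓛 w (act 𝓛 (reverse w) X) ≡ X
  act-act-reverse w {X} X∈𝓛 = begin
    act 𝓛 w (act 𝓛 (reverse w) X)                        ≡⟨ cong (λ u → act 𝓛 u (act 𝓛 (reverse w) X)) (reverse-involutive w) ⟨
    act 𝓛 (reverse (reverse w)) (act 𝓛 (reverse w) X)    ≡⟨ act-reverse-act (reverse w) X∈𝓛 ⟩
    X                                                    ∎
    where open ≡-Reasoning

  toggle-stabilises : ∀ e {Q : Pred n} → Q ⊆ (_∈L 𝓛) →
                      MapsInto (toggle 𝓛 e) Q → Stabilises 𝓛 [ e ] Q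
  toggle-stabilises e Q⊆𝓛 into =
    (λ { _ (X , qX , refl) → into qX }) ,
    (λ X qX → toggle 𝓛 e X , into qX , toggle-involutive e (Q⊆𝓛 qX))

  Splits : Fin n → Pred n → Set
  Splits e Q = (∃[ A ] Q A × ¬ Moves e A) × (∃[ C ] Q C × Moves e C)

  Splits-mono : ∀ {e} {Q R : Pred n} → Q ⊆ R → Splits e Q → Splits e R
  Splits-mono Q⊆R ((A , qA , ¬mA) , (C , qC , mC)) = (A , Q⊆R qA , ¬mA) , (C , Q⊆R qC , mC)

  unsplit-toggle-translation : ∀ e {Q : Pred n} → ∃ Q → ¬ Splits e Q →
                               ∃[ Y ] ActsAsTranslation (toggle 𝓛 e) Q Y
  unsplit-toggle-translation e (A₀ , qA₀) ¬split with moves? e A₀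
  ... | yes mA₀ = ⁅ e ⁆ , λ A qA → toggle-moved
          (decidable-stable (moves? e A) λ ¬mA → ¬split ((A , qA , ¬mA) , (A₀ , qA₀ , mA₀)))
  ... | no ¬mA₀ = ∅ , λ A qA → trans
          (toggle-fixed λ mA → ¬split ((A₀ , qA₀ , ¬mA₀) , (A , qA , mA)))
          (sym (△-identityʳ A))

module Translates (𝓛 : Family n) (𝓑₀ : Pred n) (𝓑₀-block : IsBlock 𝓛 𝓑₀) where
  open Toggles 𝓛

  Block : Word n → Pred n
  Block g = image 𝓛 g 𝓑₀

  Block⊆𝓛 : ∀ g → Block g ⊆ (_∈L 𝓛)
  Block⊆𝓛 g (C , C∈𝓑₀ , refl) = act-∈ g (proj₁ 𝓑₀-block C C∈𝓑₀)

  Block-nonempty : ∀ g → ∃ (Block g)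
  Block-nonempty g with proj₁ (proj₂ 𝓑₀-block)
  ... | C , C∈𝓑₀ = act 𝓛 g C , C , C∈𝓑₀ , refl

  act-Block : ∀ u g {X} → Block g X → Block (u ++ g) (act 𝓛 u X)
  act-Block u g (C , C∈𝓑₀ , refl) = C , C∈𝓑₀ , act-++ u g C

  toggle-Block : ∀ f g {X} → Block g X → Block (f ∷ g) (toggle 𝓛 f X)
  toggle-Block f g = act-Block [ f ] g

  act-conjugate : ∀ g h D →
                  act 𝓛 (reverse g ++ h ++ g) D ≡ act 𝓛 (reverse g) (act 𝓛 h (act 𝓛 g D))
  act-conjugate g h D =
    trans (act-++ (reverse g) (h ++ g) D) (cong (act 𝓛 (reverse g)) (act-++ h g D))

  -- reverse g acts as g⁻¹ on 𝓛; apply the block property of 𝓑₀ to g⁻¹ h g.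
  Block-into-or-out : ∀ g h → MapsInto (act 𝓛 h) (Block g)
                              ⊎ (∀ {X} → Block g X → ¬ Block g (act 𝓛 h X))
  Block-into-or-out g h with proj₂ (proj₂ 𝓑₀-block) (reverse g ++ h ++ g)
  ... | inj₁ (into , _) = inj₁ λ { (D , D∈𝓑₀ , refl) →
          act 𝓛 w D , into (act 𝓛 w D) (D , D∈𝓑₀ , refl) , (begin
            act 𝓛 g (act 𝓛 w D)                                    ≡⟨ cong (act 𝓛 g) (act-conjugate g h D) ⟩
            act 𝓛 g (act 𝓛 (reverse g) (act 𝓛 h (act 𝓛 g D)))     ≡⟨ act-act-reverse g (act-∈ h (Block⊆𝓛 g (D , D∈𝓑₀ , refl))) ⟩
            act 𝓛 h (act 𝓛 g D)                                    ∎) }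
    where
    open ≡-Reasoning
    w = reverse g ++ h ++ g
  ... | inj₂ disjoint = inj₂ λ { (D , D∈𝓑₀ , refl) (D′ , D′∈𝓑₀ , gD′≡hgD) →
          disjoint D′ (D , D∈𝓑₀ , (begin
            act 𝓛 (reverse g ++ h ++ g) D                ≡⟨ act-conjugate g h D ⟩
            act 𝓛 (reverse g) (act 𝓛 h (act 𝓛 g D))     ≡⟨ cong (act 𝓛 (reverse g)) gD′≡hgD ⟨
            act 𝓛 (reverse g) (act 𝓛 g D′)              ≡⟨ act-reverse-act g (proj₁ 𝓑₀-block D′ D′∈𝓑₀) ⟩
            D′                                           ∎)) D′∈𝓑₀ }
    where open ≡-Reasoning

  Block-into-if-one : ∀ g h {A} → Block g A → Block g (act 𝓛 h A) → MapsInto (act 𝓛 h) (Block g)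
  Block-into-if-one g h qA qhA with Block-into-or-out g h
  ... | inj₁ into = into
  ... | inj₂ out  = contradiction qhA (out qA)

  Splits⇒into : ∀ e g → Splits e (Block g) → MapsInto (toggle 𝓛 e) (Block g)
  Splits⇒into e g ((A , qA , ¬mA) , _) =
    Block-into-if-one g [ e ] qA (subst (Block g) (sym (toggle-fixed ¬mA)) qA)

  Splits-shift : ∀ e f g → (∀ {X} → Block g X → ¬ Block g (toggle 𝓛 f X)) →
                 Splits e (Block g) → Splits e (Block (f ∷ g))
  Splits-shift e f g out s@((A , qA , ¬mA) , (C , qC , mC)) =
    (A △ ⁅ f ⁆ , shift qA , ¬mA′) , (C △ ⁅ f ⁆ , shift qC , mC′)
    where
    moved : ∀ {X} → Block g X → Moves f X
    moved {X} qX = decidable-stable (moves? f X) λ ¬m →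
      out qX (subst (Block g) (sym (toggle-fixed ¬m)) qX)

    shift : ∀ {X} → Block g X → Block (f ∷ g) (X △ ⁅ f ⁆)
    shift qX = subst (Block (f ∷ g)) (toggle-moved (moved qX)) (toggle-Block f g qX)

    unshift : ∀ {Y} → Block (f ∷ g) Y → Block g (Y △ ⁅ f ⁆)
    unshift (D , D∈𝓑₀ , refl) =
      let qD = D , D∈𝓑₀ , refl
      in subst (Block g)
           (sym (trans (cong (_△ ⁅ f ⁆) (toggle-moved (moved qD))) (△-cancelʳ _ ⁅ f ⁆))) qD

    qCe : Block g (C △ ⁅ e ⁆)
    qCe = subst (Block g) (toggle-moved mC) (Splits⇒into e g s qC)

    mC′ : Moves e (C △ ⁅ f ⁆)
    mC′ = subst (_∈L 𝓛) (△-swapʳ C ⁅ e ⁆ ⁅ f ⁆) (moved qCe)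

    into′ : MapsInto (toggle 𝓛 e) (Block (f ∷ g))
    into′ = Block-into-if-one (f ∷ g) [ e ] (shift qC)
      (subst (Block (f ∷ g)) (trans (△-swapʳ C ⁅ e ⁆ ⁅ f ⁆) (sym (toggle-moved mC′))) (shift qCe))

    ¬mA′ : ¬ Moves e (A △ ⁅ f ⁆)
    ¬mA′ mA′ = ¬mA (Block⊆𝓛 g (subst (Block g) unshifted
      (unshift (subst (Block (f ∷ g)) (toggle-moved mA′) (into′ (shift qA))))))
      where
      unshifted : ((A △ ⁅ f ⁆) △ ⁅ e ⁆) △ ⁅ f ⁆ ≡ A △ ⁅ e ⁆
      unshifted = trans (△-swapʳ (A △ ⁅ f ⁆) ⁅ e ⁆ ⁅ f ⁆) (cong (_△ ⁅ e ⁆) (△-cancelʳ A ⁅ f ⁆))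

  Splits-toggle : ∀ e f g → Splits e (Block g) → Splits e (Block (f ∷ g))
  Splits-toggle e f g s with Block-into-or-out g [ f ]
  ... | inj₂ out  = Splits-shift e f g out s
  ... | inj₁ into = Splits-mono (λ qX → subst (Block (f ∷ g))
          (toggle-involutive f (Block⊆𝓛 g qX)) (toggle-Block f g (into qX))) s

  Splits-++ : ∀ e u g → Splits e (Block g) → Splits e (Block (u ++ g))
  Splits-++ e []      g s = s
  Splits-++ e (f ∷ u) g s = Splits-toggle e f (u ++ g) (Splits-++ e u g s)

  Splits-everywhere : ∀ e g → Splits e (Block g) → ∀ g′ → Splits e (Block g′)
  Splits-everywhere e g s g′ =
    Splits-mono cancel (subst (λ w → Splits e (Block w)) (++-assoc g′ (reverse g) g)
                              (Splits-++ e (g′ ++ reverse g) g s))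
    where
    cancel : Block (g′ ++ reverse g ++ g) ⊆ Block g′
    cancel (C , C∈𝓑₀ , refl) = C , C∈𝓑₀ , (begin
      act 𝓛 g′ C                                       ≡⟨ cong (act 𝓛 g′) (act-reverse-act g (proj₁ 𝓑₀-block C C∈𝓑₀)) ⟨
      act 𝓛 g′ (act 𝓛 (reverse g) (act 𝓛 g C))         ≡⟨ cong (act 𝓛 g′) (act-++ (reverse g) g C) ⟨
      act 𝓛 g′ (act 𝓛 (reverse g ++ g) C)              ≡⟨ act-++ g′ (reverse g ++ g) C ⟨
      act 𝓛 (g′ ++ reverse g ++ g) C                   ∎)
      where open ≡-Reasoning

  type1⇒¬Splits : ∀ {e} → Type1Toggle 𝓛 𝓑₀ e → ∀ g → ¬ Splits e (Block g)
  type1⇒¬Splits {e} type1 g s = type1 λ g′ →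
    toggle-stabilises e (Block⊆𝓛 g′) (Splits⇒into e g′ (Splits-everywhere e g s g′))

  type1-word-translation : ∀ σ → All (Type1Toggle 𝓛 𝓑₀) σ → ∀ g →
                           ∃[ X ] ActsAsTranslation (act 𝓛 σ) (Block g) X
  type1-word-translation []      []              g = ∅ , λ A _ → sym (△-identityʳ A)
  type1-word-translation (e ∷ σ) (type1 ∷ type1s) g with type1-word-translation σ type1s g
  ... | X , σ≡△X with unsplit-toggle-translation e (Block-nonempty (σ ++ g)) (type1⇒¬Splits type1 (σ ++ g))
  ... | Y , τ≡△Y = X △ Y , λ A qA → begin
    toggle 𝓛 e (act 𝓛 σ A)  ≡⟨ τ≡△Y (act 𝓛 σ A) (act-Block σ g qA) ⟩
    act 𝓛 σ A △ Y           ≡⟨ cong (_△ Y) (σ≡△X A qA) ⟩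
    (A △ X) △ Y             ≡⟨ △-assoc A X Y ⟩
    A △ (X △ Y)             ∎
    where open ≡-Reasoning

lemma2p4 : (n : ℕ) (𝓛 : Family n) → Transitive 𝓛 →
           (𝓑₀ : Pred n) → IsBlock 𝓛 𝓑₀ →
           (σ : Word n) → All (Type1Toggle 𝓛 𝓑₀) σ →
           (g : Word n) →
           (∃[ X ] (∀ A → image 𝓛 g 𝓑₀ A → act 𝓛 σ A ≡ A △ X))
           × (Stabilises 𝓛 σ (image 𝓛 g 𝓑₀) →
                (∀ A → image 𝓛 g 𝓑₀ A → act 𝓛 σ A ≡ A)
                ⊎ (∀ A → image 𝓛 g 𝓑₀ A →
                     (act 𝓛 σ (act 𝓛 σ A) ≡ A) × ¬ (act 𝓛 σ A ≡ A)))
lemma2p4 n 𝓛 _ 𝓑₀ 𝓑₀-block σ type1s g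
  with Translates.type1-word-translation 𝓛 𝓑₀ 𝓑₀-block σ type1s g
... | X , σ≡△X = (X , σ≡△X) , λ (into , _) →
  translation-trivial-or-free X σ≡△X λ {A} qA → into (act 𝓛 σ A) (A , qA , refl)
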